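{- Let $\mathcal{A}$ be a finite non-empty separating union-closed family of sets whose universe $U(\mathcal{A})=\bigcup_{A\in\mathcal{A}}A$ has $m$ elements. If $|\mathcal{A}|\leq 2m$, then there exists an element $x\in U(\mathcal{A})$ with $|\{A\in\mathcal{A}:\, x\in A\}|\geq \frac{1}{2}|\mathcal{A}|$.
   Context: A family $\mathcal{A}$ of sets is union-closed if $A\cup B\in\mathcal{A}$ for all $A,B\in\mathcal{A}$. It is separating if for any two distinct elements $x,y\in U(\mathcal{A})$ there is a set $A\in\mathcal{A}$ containing exactly one of $x$ and $y$. The frequency of $x$ is $|\{A\in\mathcal{A}:\, x\in A\}|$. -}

module Defs where

open import Data.Nat using (ℕ)
open import Data.Fin using (Fin)
open import Data.Fin.Subset using (Subset; _∈_; _∉_; _∪_; ⋃)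
open import Data.Fin.Subset.Properties using (_∈?_)
open import Data.List using (List; length; filter)
open import Data.List.Membership.Propositional using () renaming (_∈_ to _∈ₗ_)
open import Data.Product using (Σ; _×_; _,_)
open import Data.Sum using (_⊎_)
open import Relation.Binary.PropositionalEquality using (_≢_)

-- A finite family of sets over the ground set Fin n, listed as a list of
-- subsets (distinctness is imposed separately via Unique).

UnionClosed : ∀ {n} → List (Subset n) → Set
UnionClosed 𝒜 = ∀ {A B} → A ∈ₗ 𝒜 → B ∈ₗ 𝒜 → (A ∪ B) ∈ₗ 𝒜

Universe : ∀ {n} → List (Subset n) → Subset n
Universe 𝒜 = ⋃ 𝒜

Separating : ∀ {n} → List (Subset n) → Set
Separating {n} 𝒜 = ∀ (x y : Fin n) → x ∈ Universe 𝒜 → y ∈ Universe 𝒜 → x ≢ y →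
  Σ (Subset n) λ A → A ∈ₗ 𝒜 × ((x ∈ A × y ∉ A) ⊎ (y ∈ A × x ∉ A))

frequency : ∀ {n} → Fin n → List (Subset n) → ℕ
frequency x 𝒜 = length (filter (x ∈?_) 𝒜)

-- For y ∈ U let M y be the union of all members of 𝒜 avoiding y; by union-closure it is the
-- largest member avoiding y. Separation makes y ↦ M y injective on U and gives, for distinct
-- x, y ∈ U, that x ∈ M y or y ∈ M x; in the second case with x ∉ M y we get M y ⊂ M x.
-- Hence an x ∈ U minimising ∣ M x ∣ lies in M y for every y ≠ x, and then U together with
-- the sets M y (y ≠ x) are ∣ U ∣ distinct members of 𝒜 containing x.
module Submission where

open import Defs
open import Data.Nat using (ℕ; suc; _≤_; _<_; _*_; z≤n; s≤s)
open import Data.Nat.Induction using (<-wellFounded)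
open import Data.Nat.Properties using (≤-trans; ≮⇒≥; <⇒≱; >⇒≢; _<?_; +-suc; *-monoʳ-≤)
open import Data.Fin using (Fin; _≟_) renaming (zero to fzero; suc to fsuc)
open import Data.Fin.Properties using (any?; suc-injective)
open import Data.Fin.Subset using (Subset; _∈_; _∉_; ⋃; _⊆_; _⊂_; ∣_∣; ⊥; Nonempty; inside; outside)
open import Data.Fin.Subset.Properties
  using (_∈?_; ∉⊥; x∈p∪q⁻; p⊆p∪q; q⊆p∪q; ∪-identityʳ; p⊂q⇒∣p∣<∣q∣; nonempty?; Empty-unique; ∣⊥∣≡0)
open import Data.Vec using ([]; _∷_; here; there)
open import Data.List using (List; []; _∷_; _++_; length; filter)
open import Data.List.Properties using (length-++)
open import Data.List.Membership.Propositional using () renaming (_∈_ to _∈ₗ_)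
open import Data.List.Membership.Propositional.Properties using (∈-filter⁺; ∈-filter⁻; ∈-∃++; ∈-++⁻; ∈-++⁺ˡ; ∈-++⁺ʳ)
open import Data.List.Relation.Unary.Any using () renaming (here to hereₗ; there to thereₗ)
open import Data.List.Relation.Unary.Unique.Propositional using (Unique)
open import Data.Product using (Σ; ∃; _×_; _,_; proj₁; proj₂)
open import Data.Sum using (_⊎_; inj₁; inj₂)
open import Data.Empty using (⊥-elim)
open import Function using (_∘_; id)
open import Induction.WellFounded using (Acc; acc)
open import Relation.Nullary using (Dec; contradiction; yes; no; ¬?; _×-dec_)
open import Relation.Unary using (Pred; Decidable)
open import Relation.Binary.PropositionalEquality using (_≡_; _≢_; refl; sym; trans; subst; cong)

x∈⋃⁻ : ∀ {n} {x : Fin n} (𝒜 : List (Subset n)) → x ∈ ⋃ 𝒜 → ∃ λ A → A ∈ₗ 𝒜 × x ∈ A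
x∈⋃⁻ [] x∈⊥ = ⊥-elim (∉⊥ x∈⊥)
x∈⋃⁻ (A ∷ 𝒜) x∈ with x∈p∪q⁻ A (⋃ 𝒜) x∈
... | inj₁ x∈A = A , hereₗ refl , x∈A
... | inj₂ x∈⋃𝒜 with x∈⋃⁻ 𝒜 x∈⋃𝒜
...   | B , B∈𝒜 , x∈B = B , thereₗ B∈𝒜 , x∈B

A⊆⋃ : ∀ {n} {A : Subset n} (𝒜 : List (Subset n)) → A ∈ₗ 𝒜 → A ⊆ ⋃ 𝒜
A⊆⋃ (B ∷ 𝒜) (hereₗ refl) = p⊆p∪q (⋃ 𝒜)
A⊆⋃ (B ∷ 𝒜) (thereₗ A∈𝒜) = q⊆p∪q B (⋃ 𝒜) ∘ A⊆⋃ 𝒜 A∈𝒜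

⋃-closed : ∀ {n} {𝒜 : List (Subset n)} → UnionClosed 𝒜 →
  (ℬ : List (Subset n)) → ℬ ≢ [] → (∀ {B} → B ∈ₗ ℬ → B ∈ₗ 𝒜) → ⋃ ℬ ∈ₗ 𝒜
⋃-closed uc [] ℬ≢[] _ = ⊥-elim (ℬ≢[] refl)
⋃-closed {𝒜 = 𝒜} uc (B ∷ []) _ ℬ⊆𝒜 = subst (_∈ₗ 𝒜) (sym (∪-identityʳ B)) (ℬ⊆𝒜 (hereₗ refl))
⋃-closed uc (B ∷ ℬ@(_ ∷ _)) _ ℬ⊆𝒜 = uc (ℬ⊆𝒜 (hereₗ refl)) (⋃-closed uc ℬ (λ ()) (ℬ⊆𝒜 ∘ thereₗ))

∣p∣>0⇒Nonempty : ∀ {n} (p : Subset n) → 0 < ∣ p ∣ → Nonempty p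
∣p∣>0⇒Nonempty {n} p 0<∣p∣ with nonempty? p
... | yes p≠∅ = p≠∅
... | no p≡∅ = contradiction (trans (cong ∣_∣ (Empty-unique p≡∅)) (∣⊥∣≡0 n)) (>⇒≢ 0<∣p∣)

-- Peels off the element of xs that the first point of p is sent to; injectivity keeps the
-- remaining points away from it.
injectiveOn⇒∣p∣≤length : ∀ {a n} {A : Set a} (p : Subset n) (f : Fin n → A) (xs : List A) →
  (∀ {y} → y ∈ p → f y ∈ₗ xs) → (∀ {y z} → y ∈ p → z ∈ p → f y ≡ f z → y ≡ z) → ∣ p ∣ ≤ length xs
injectiveOn⇒∣p∣≤length [] f xs _ _ = z≤n
injectiveOn⇒∣p∣≤length (outside ∷ p) f xs into inj =
  injectiveOn⇒∣p∣≤length p (f ∘ fsuc) xs (into ∘ there)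
    (λ y∈ z∈ → suc-injective ∘ inj (there y∈) (there z∈))
injectiveOn⇒∣p∣≤length (inside ∷ p) f xs into inj with ∈-∃++ (into here)
... | ys , zs , refl = subst (suc ∣ p ∣ ≤_) (sym length-split)
  (s≤s (injectiveOn⇒∣p∣≤length p (f ∘ fsuc) (ys ++ zs) into′
    (λ y∈ z∈ → suc-injective ∘ inj (there y∈) (there z∈))))
  where
  into′ : ∀ {y} → y ∈ p → f (fsuc y) ∈ₗ ys ++ zs
  into′ y∈p with ∈-++⁻ ys (into (there y∈p))
  ... | inj₁ ∈ys = ∈-++⁺ˡ ∈ys
  ... | inj₂ (thereₗ ∈zs) = ∈-++⁺ʳ ys ∈zs
  ... | inj₂ (hereₗ f[y]≡f[0]) with inj (there y∈p) here f[y]≡f[0]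
  ...   | ()
  length-split : length (ys ++ f fzero ∷ zs) ≡ suc (length (ys ++ zs))
  length-split rewrite length-++ ys {f fzero ∷ zs} | length-++ ys {zs} = +-suc (length ys) (length zs)

≢[]∧length≤2*m⇒0<m : ∀ {a} {A : Set a} {xs : List A} {m} → xs ≢ [] → length xs ≤ 2 * m → 0 < m
≢[]∧length≤2*m⇒0<m {xs = []} xs≢[] _ = ⊥-elim (xs≢[] refl)
≢[]∧length≤2*m⇒0<m {xs = _ ∷ _} {m = suc _} _ _ = s≤s z≤n

∃-minimiser : ∀ {n p} {P : Pred (Fin n) p} → Decidable P → (μ : Fin n → ℕ) → ∃ P →
  ∃ λ z → P z × (∀ {y} → P y → μ z ≤ μ y)
∃-minimiser {P = P} P? μ (x , Px) = descend x Px (<-wellFounded (μ x))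
  where
  descend : ∀ x → P x → Acc _<_ (μ x) → ∃ λ z → P z × (∀ {y} → P y → μ z ≤ μ y)
  descend x Px (acc rec) with any? (λ y → P? y ×-dec (μ y <? μ x))
  ... | yes (y , Py , μy<μx) = descend y Py (rec μy<μx)
  ... | no ∄smaller = x , Px , λ {y} Py → ≮⇒≥ (λ μy<μx → ∄smaller (y , Py , μy<μx))

module MaxAvoiding {n : ℕ} (𝒜 : List (Subset n)) (uc : UnionClosed 𝒜) (sep : Separating 𝒜) where

  U : Subset n
  U = Universe 𝒜

  avoiding : Fin n → List (Subset n)
  avoiding y = filter (¬? ∘ (y ∈?_)) 𝒜

  maxAvoiding : Fin n → Subset n
  maxAvoiding y = ⋃ (avoiding y)

  ∈avoiding⁻ : ∀ {y A} → A ∈ₗ avoiding y → A ∈ₗ 𝒜 × y ∉ A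
  ∈avoiding⁻ {y} = ∈-filter⁻ (¬? ∘ (y ∈?_))

  y∉maxAvoiding : ∀ y → y ∉ maxAvoiding y
  y∉maxAvoiding y y∈ with x∈⋃⁻ (avoiding y) y∈
  ... | A , A∈ , y∈A = proj₂ (∈avoiding⁻ A∈) y∈A

  avoiding⊆maxAvoiding : ∀ {A} y → A ∈ₗ 𝒜 → y ∉ A → A ⊆ maxAvoiding y
  avoiding⊆maxAvoiding y A∈𝒜 y∉A = A⊆⋃ (avoiding y) (∈-filter⁺ (¬? ∘ (y ∈?_)) A∈𝒜 y∉A)

  maxAvoiding∈ : ∀ {x} y → x ∈ maxAvoiding y → maxAvoiding y ∈ₗ 𝒜
  maxAvoiding∈ {x} y x∈ = ⋃-closed uc (avoiding y) avoiding≢[] (proj₁ ∘ ∈avoiding⁻)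
    where
    avoiding≢[] : avoiding y ≢ []
    avoiding≢[] eq = ∉⊥ (subst (λ ℬ → x ∈ ⋃ ℬ) eq x∈)

  separates : ∀ {x y} → x ∈ U → y ∈ U → x ≢ y → x ∈ maxAvoiding y ⊎ y ∈ maxAvoiding x
  separates {x} {y} x∈U y∈U x≢y with sep x y x∈U y∈U x≢y
  ... | A , A∈𝒜 , inj₁ (x∈A , y∉A) = inj₁ (avoiding⊆maxAvoiding y A∈𝒜 y∉A x∈A)
  ... | A , A∈𝒜 , inj₂ (y∈A , x∉A) = inj₂ (avoiding⊆maxAvoiding x A∈𝒜 x∉A y∈A)

  maxAvoiding-injective : ∀ {x y} → x ∈ U → y ∈ U → maxAvoiding x ≡ maxAvoiding y → x ≡ y
  maxAvoiding-injective {x} {y} x∈U y∈U eq with x ≟ y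
  ... | yes x≡y = x≡y
  ... | no x≢y with separates x∈U y∈U x≢y
  ...   | inj₁ x∈My = ⊥-elim (y∉maxAvoiding x (subst (x ∈_) (sym eq) x∈My))
  ...   | inj₂ y∈Mx = ⊥-elim (y∉maxAvoiding y (subst (y ∈_) eq y∈Mx))

  ∉maxAvoiding⇒⊂ : ∀ {x y} → x ∈ U → y ∈ U → x ≢ y → x ∉ maxAvoiding y → maxAvoiding y ⊂ maxAvoiding x
  ∉maxAvoiding⇒⊂ {x} {y} x∈U y∈U x≢y x∉My = My⊆Mx , y , y∈Mx , y∉maxAvoiding y
    where
    My⊆Mx : maxAvoiding y ⊆ maxAvoiding x
    My⊆Mx z∈My with x∈⋃⁻ (avoiding y) z∈My
    ... | A , A∈ , z∈A with ∈avoiding⁻ A∈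
    ...   | A∈𝒜 , y∉A = avoiding⊆maxAvoiding x A∈𝒜 (x∉My ∘ avoiding⊆maxAvoiding y A∈𝒜 y∉A) z∈A
    y∈Mx : y ∈ maxAvoiding x
    y∈Mx with separates x∈U y∈U x≢y
    ... | inj₁ x∈My = ⊥-elim (x∉My x∈My)
    ... | inj₂ y∈Mx = y∈Mx

  ∃∈allMaxAvoiding : Nonempty U → ∃ λ x → x ∈ U × (∀ {y} → y ∈ U → y ≢ x → x ∈ maxAvoiding y)
  ∃∈allMaxAvoiding U≠∅ with ∃-minimiser (_∈? U) (∣_∣ ∘ maxAvoiding) U≠∅
  ... | x , x∈U , minimal = x , x∈U , x∈My
    where
    x∈My : ∀ {y} → y ∈ U → y ≢ x → x ∈ maxAvoiding y
    x∈My {y} y∈U y≢x with x ∈? maxAvoiding y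
    ... | yes x∈My = x∈My
    ... | no x∉My =
      contradiction (minimal y∈U) (<⇒≱ (p⊂q⇒∣p∣<∣q∣ (∉maxAvoiding⇒⊂ x∈U y∈U (y≢x ∘ sym) x∉My)))

  ∣U∣≤frequency : 𝒜 ≢ [] → Nonempty U → ∃ λ x → x ∈ U × ∣ U ∣ ≤ frequency x 𝒜
  ∣U∣≤frequency 𝒜≢[] U≠∅ with ∃∈allMaxAvoiding U≠∅
  ... | x , x∈U , x∈My = x , x∈U ,
    injectiveOn⇒∣p∣≤length U (λ y → witness y (y ≟ x)) (filter (x ∈?_) 𝒜)
      (λ {y} y∈U → witness∈ y∈U (y ≟ x))
      (λ {y} {z} y∈U z∈U → witness-injective y∈U z∈U (y ≟ x) (z ≟ x))
    where
    witness : ∀ y → Dec (y ≡ x) → Subset n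
    witness y (yes _) = U
    witness y (no _) = maxAvoiding y

    witness∈ : ∀ {y} → y ∈ U → (d : Dec (y ≡ x)) → witness y d ∈ₗ filter (x ∈?_) 𝒜
    witness∈ y∈U (yes _) = ∈-filter⁺ (x ∈?_) (⋃-closed uc 𝒜 𝒜≢[] id) x∈U
    witness∈ y∈U (no y≢x) = ∈-filter⁺ (x ∈?_) (maxAvoiding∈ _ (x∈My y∈U y≢x)) (x∈My y∈U y≢x)

    witness-injective : ∀ {y z} → y ∈ U → z ∈ U → (d : Dec (y ≡ x)) (d′ : Dec (z ≡ x)) →
      witness y d ≡ witness z d′ → y ≡ z
    witness-injective _ _ (yes y≡x) (yes z≡x) _ = trans y≡x (sym z≡x)
    witness-injective {z = z} _ z∈U (yes _) (no _) eq = ⊥-elim (y∉maxAvoiding z (subst (z ∈_) eq z∈U))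
    witness-injective {y} y∈U _ (no _) (yes _) eq = ⊥-elim (y∉maxAvoiding y (subst (y ∈_) (sym eq) y∈U))
    witness-injective y∈U z∈U (no _) (no _) eq = maxAvoiding-injective y∈U z∈U eq

mainTheorem1 : ∀ (n : ℕ) (𝒜 : List (Subset n)) → Unique 𝒜 → 𝒜 ≢ [] →
    UnionClosed 𝒜 → Separating 𝒜 →
    length 𝒜 ≤ 2 * ∣ Universe 𝒜 ∣ →
    Σ (Fin n) λ x → x ∈ Universe 𝒜 × length 𝒜 ≤ 2 * frequency x 𝒜
mainTheorem1 n 𝒜 _ 𝒜≢[] uc sep |𝒜|≤2|U| with MaxAvoiding.∣U∣≤frequency 𝒜 uc sep 𝒜≢[] U≠∅
  where
  U≠∅ : Nonempty (Universe 𝒜)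
  U≠∅ = ∣p∣>0⇒Nonempty (Universe 𝒜) (≢[]∧length≤2*m⇒0<m 𝒜≢[] |𝒜|≤2|U|)
... | x , x∈U , ∣U∣≤freq = x , x∈U , ≤-trans |𝒜|≤2|U| (*-monoʳ-≤ 2 ∣U∣≤freq)
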